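{- Let $A,B\in\mathsf{ASM}(n)$ with $A\le B$ in strong order, and let $i\in[n-1]$. Then $\pi_i(A)\le\pi_i(B)$. Equivalently, if $I_A\subseteq I_B$, then $I_{\pi_i(A)}\subseteq I_{\pi_i(B)}$.
   Context: An $n\times n$ alternating sign matrix (ASM) is a matrix with entries in $\{ -1,0,1\}$ whose nonzero entries in each row and each column alternate in sign and sum to $1$; $\mathsf{ASM}(n)$ is the set of these. The corner sum function is $\mathrm{rk}_A(i,j)=\sum_{a\le i,\,b\le j}A_{a,b}$. Strong order: $A\le B$ iff $\mathrm{rk}_A(i,j)\ge\mathrm{rk}_B(i,j)$ for all $i,j\in[n]$. Over a field $\kappa$, with $S=\kappa[z_{i,j}:i,j\in[n]]$ and $Z=(z_{i,j})$, the ASM ideal is $I_A=\sum_{i,j}I_{\mathrm{rk}_A(i,j)+1}(Z_{[i],[j]})$, where $I_k(Z_{[i],[j]})$ is generated by the $k$-minors of the upper-left $i\times j$ submatrix; $A\le B$ iff $I_A\subseteq I_B$. For $i\in[n-1]$, $\pi_i(A)$ is the strong-order minimum of $\{B\in\mathsf{ASM}(n):\mathrm{rk}_B(a,b)=\mathrm{rk}_A(a,b)\text{ for all }a\neq i\}$. -}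

module Defs where

open import Data.Nat using (ℕ; suc; _<_)
open import Data.Fin using (Fin; toℕ; _≤?_)
open import Data.Fin.Properties using (_≟_)
open import Data.Integer using (ℤ; _+_; -_; 0ℤ; 1ℤ; -1ℤ; _≥_)
import Data.Integer.Properties as ℤP
open import Data.List using (List; []; _∷_; map; filter; foldr; allFin)
open import Data.Product using (_×_)
open import Data.Sum using (_⊎_)
open import Relation.Binary.PropositionalEquality using (_≡_; _≢_)
open import Relation.Nullary.Decidable using (¬?)

-- n × n integer matrices, indexed 0-based by Fin n (row, column).
Matrix : ℕ → Set
Matrix n = Fin n → Fin n → ℤ

sumℤ : List ℤ → ℤ
sumℤ = foldr _+_ 0ℤ

nonzeros : List ℤ → List ℤ
nonzeros = filter (λ x → ¬? (x ℤP.≟ 0ℤ))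

data Alternating : List ℤ → Set where
  alt-[]  : Alternating []
  alt-[_] : ∀ x → Alternating (x ∷ [])
  alt-∷   : ∀ {x y xs} → y ≡ - x → Alternating (y ∷ xs) → Alternating (x ∷ y ∷ xs)

row : ∀ {n} → Matrix n → Fin n → List ℤ
row {n} A i = map (λ j → A i j) (allFin n)

col : ∀ {n} → Matrix n → Fin n → List ℤ
col {n} A j = map (λ i → A i j) (allFin n)

AltSum1 : List ℤ → Set
AltSum1 xs = Alternating (nonzeros xs) × sumℤ (nonzeros xs) ≡ 1ℤ

record IsASM {n : ℕ} (A : Matrix n) : Set where
  field
    entries : ∀ i j → (A i j ≡ -1ℤ) ⊎ ((A i j ≡ 0ℤ) ⊎ (A i j ≡ 1ℤ))
    rows    : ∀ i → AltSum1 (row A i)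
    cols    : ∀ j → AltSum1 (col A j)

rk : ∀ {n} → Matrix n → Fin n → Fin n → ℤ
rk {n} A i j =
  sumℤ (map (λ a → sumℤ (map (λ b → A a b) (filter (_≤? j) (allFin n))))
            (filter (_≤? i) (allFin n)))

_≤ₛ_ : ∀ {n} → Matrix n → Matrix n → Set
A ≤ₛ B = ∀ i j → rk A i j ≥ rk B i j

record IsPi {n : ℕ} (i : Fin n) (A P : Matrix n) : Set where
  field
    isASM   : IsASM P
    agrees  : ∀ a b → a ≢ i → rk P a b ≡ rk A a b
    minimal : ∀ (B : Matrix n) → IsASM B → (∀ a b → a ≢ i → rk B a b ≡ rk A a b) → P ≤ₛ B

-- The corner sum functions of n × n ASMs are exactly the integer arrays on [0,n]² with the
-- boundary values of a permutation matrix whose consecutive differences in either direction lie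
-- in {0,1} (Robbins–Rumsey). That class is closed under pointwise maximum, so two ASMs X, Y have
-- a join X ∨ Y with rk (X ∨ Y) = max (rk X) (rk Y). Off row i the corner sums of π_i(A) and
-- π_i(B) are those of A and B, and rk A ≥ rk B there, so π_i(A) ∨ π_i(B) is a competitor in the
-- definition of π_i(A); minimality then gives rk π_i(A) ≥ rk (π_i(A) ∨ π_i(B)) ≥ rk π_i(B).
module Submission where

open import Defs
open import Data.Nat as ℕ using (ℕ; zero; suc; _<_; _≤_; _≤′_; ≤′-reflexive; ≤′-step; z≤n; s≤s)
import Data.Nat.Properties as ℕP
open import Data.Fin using (Fin; toℕ; fromℕ<; _≤?_)
import Data.Fin.Properties as FinP
open import Data.Integer using (ℤ; +_; 0ℤ; 1ℤ; -1ℤ; _+_; _-_; -_; _⊔_; +≤+) renaming (_≤_ to _≤ᶻ_)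
import Data.Integer.Properties as ℤP
open import Data.Integer.Tactic.RingSolver using (solve-∀)
open import Algebra.Properties.CommutativeSemigroup ℤP.+-commutativeSemigroup using (interchange)
open import Algebra.Properties.AbelianGroup ℤP.+-0-abelianGroup using (//-rightDividesˡ; //-rightDividesʳ; xyx⁻¹≈y)
open import Data.List using (List; []; _∷_; map; filter; allFin; applyUpTo; tabulate)
import Data.List.Properties as ListP
open import Data.List.Relation.Unary.All using (All; []; _∷_)
import Data.List.Relation.Unary.All.Properties as AllP
open import Data.Bool using (true; false; if_then_else_)
open import Data.Product using (_×_; _,_; ∃)
open import Data.Sum using (_⊎_; inj₁; inj₂)
open import Data.Empty using (⊥-elim)
open import Function using (_∘_)
open import Relation.Nullary using (yes; no; does)
open import Relation.Nullary.Decidable using (¬?; dec-true; dec-false)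
open import Relation.Unary using (Pred; Decidable)
open import Relation.Binary.PropositionalEquality

∑ : ℕ → (ℕ → ℤ) → ℤ
∑ k g = sumℤ (applyUpTo g k)

∑-cong : ∀ k {f g : ℕ → ℤ} → (∀ j → j < k → f j ≡ g j) → ∑ k f ≡ ∑ k g
∑-cong zero    f≗g = refl
∑-cong (suc k) f≗g = cong₂ _+_ (f≗g 0 (s≤s z≤n)) (∑-cong k (λ j j<k → f≗g (suc j) (s≤s j<k)))

∑-zero : ∀ k → ∑ k (λ _ → 0ℤ) ≡ 0ℤ
∑-zero zero    = refl
∑-zero (suc k) = trans (ℤP.+-identityˡ _) (∑-zero k)

∑-suc : ∀ k (g : ℕ → ℤ) → ∑ (suc k) g ≡ ∑ k g + g k
∑-suc zero    g = trans (ℤP.+-identityʳ (g 0)) (sym (ℤP.+-identityˡ (g 0)))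
∑-suc (suc k) g = trans (cong (_+_ (g 0)) (∑-suc k (g ∘ suc))) (sym (ℤP.+-assoc (g 0) _ _))

∑-+ : ∀ k (f g : ℕ → ℤ) → ∑ k (λ j → f j + g j) ≡ ∑ k f + ∑ k g
∑-+ zero    f g = refl
∑-+ (suc k) f g =
  trans (cong (_+_ (f 0 + g 0)) (∑-+ k (f ∘ suc) (g ∘ suc))) (interchange (f 0) (g 0) _ _)

∑-telescope : ∀ k (f : ℕ → ℤ) → ∑ k (λ j → f (suc j) - f j) ≡ f k - f 0
∑-telescope zero    f = sym (ℤP.+-inverseʳ (f 0))
∑-telescope (suc k) f =
  trans (cong (_+_ (f 1 - f 0)) (∑-telescope k (f ∘ suc))) (chain (f 0) (f 1) (f (suc k)))
  where
  chain : ∀ a b c → (b - a) + (c - b) ≡ c - a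
  chain = solve-∀

restrict : ℕ → (ℕ → ℤ) → ℕ → ℤ
restrict k g q = if does (q ℕ.≤? k) then g q else 0ℤ

∑-restrict-below : ∀ m k (g : ℕ → ℤ) → m ≤ suc k → ∑ m (restrict k g) ≡ ∑ m g
∑-restrict-below m k g m≤1+k = ∑-cong m λ j j<m →
  cong (if_then g j else 0ℤ) (dec-true (j ℕ.≤? k) (ℕP.≤-pred (ℕP.≤-trans j<m m≤1+k)))

∑-restrict-above : ∀ m k (g : ℕ → ℤ) → suc k ≤ m → ∑ m (restrict k g) ≡ ∑ (suc k) g
∑-restrict-above m k g k<m = go (ℕP.≤⇒≤′ k<m)
  where
  go : ∀ {m} → suc k ≤′ m → ∑ m (restrict k g) ≡ ∑ (suc k) g
  go (≤′-reflexive refl) = ∑-restrict-below (suc k) k g ℕP.≤-refl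
  go (≤′-step {m} k<m) = begin
    ∑ (suc m) (restrict k g)           ≡⟨ ∑-suc m (restrict k g) ⟩
    ∑ m (restrict k g) + restrict k g m ≡⟨ cong₂ _+_ (go k<m) (cong (if_then g m else 0ℤ) m≰k) ⟩
    ∑ (suc k) g + 0ℤ                    ≡⟨ ℤP.+-identityʳ _ ⟩
    ∑ (suc k) g                         ∎
    where
    open ≡-Reasoning
    m≰k = dec-false (m ℕ.≤? k) (ℕP.<⇒≱ (ℕP.≤′⇒≤ k<m))

sumℤ-map-filter : ∀ {A : Set} {ℓ} {P : Pred A ℓ} (P? : Decidable P) (f : A → ℤ) xs →
  sumℤ (map f (filter P? xs)) ≡ sumℤ (map (λ x → if does (P? x) then f x else 0ℤ) xs)
sumℤ-map-filter P? f []       = refl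
sumℤ-map-filter P? f (x ∷ xs) with does (P? x)
... | true  = cong (_+_ (f x)) (sumℤ-map-filter P? f xs)
... | false = trans (sumℤ-map-filter P? f xs) (sym (ℤP.+-identityˡ _))

tabulate-toℕ : ∀ {A : Set} n (g : ℕ → A) → tabulate {n = n} (g ∘ toℕ) ≡ applyUpTo g n
tabulate-toℕ zero    g = refl
tabulate-toℕ (suc n) g = cong (g 0 ∷_) (tabulate-toℕ n (g ∘ suc))

map-allFin : ∀ {A : Set} n (g : ℕ → A) → map (g ∘ toℕ) (allFin n) ≡ applyUpTo g n
map-allFin n g = trans (ListP.map-tabulate (λ x → x) (g ∘ toℕ)) (tabulate-toℕ n g)

sumℤ-filter-≤ : ∀ n (g : ℕ → ℤ) (y : Fin n) →
  sumℤ (map (g ∘ toℕ) (filter (_≤? y) (allFin n))) ≡ ∑ (suc (toℕ y)) g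
sumℤ-filter-≤ n g y = begin
  sumℤ (map (g ∘ toℕ) (filter (_≤? y) (allFin n)))  ≡⟨ sumℤ-map-filter (_≤? y) (g ∘ toℕ) (allFin n) ⟩
  sumℤ (map (restrict (toℕ y) g ∘ toℕ) (allFin n))  ≡⟨ cong sumℤ (map-allFin n (restrict (toℕ y) g)) ⟩
  ∑ n (restrict (toℕ y) g)                          ≡⟨ ∑-restrict-above n (toℕ y) g (FinP.toℕ<n y) ⟩
  ∑ (suc (toℕ y)) g                                 ∎
  where open ≡-Reasoning

rk-cong : ∀ {n} {X Y : Matrix n} → (∀ a b → X a b ≡ Y a b) → ∀ x y → rk X x y ≡ rk Y x y
rk-cong {n} X≗Y x y = cong sumℤ (ListP.map-cong
  (λ a → cong sumℤ (ListP.map-cong (X≗Y a) (filter (_≤? y) (allFin n)))) (filter (_≤? x) (allFin n)))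

rk-toℕ : ∀ n (F : ℕ → ℕ → ℤ) (x y : Fin n) →
  rk {n} (λ a b → F (toℕ a) (toℕ b)) x y ≡ ∑ (suc (toℕ x)) (λ a → ∑ (suc (toℕ y)) (F a))
rk-toℕ n F x y = trans
  (cong sumℤ (ListP.map-cong (λ a → sumℤ-filter-≤ n (F (toℕ a)) y) (filter (_≤? x) (allFin n))))
  (sumℤ-filter-≤ n (λ a → ∑ (suc (toℕ y)) (F a)) x)

entry : ∀ {n} → Matrix n → ℕ → ℕ → ℤ
entry {n} X a b with a ℕ.<? n | b ℕ.<? n
... | yes a<n | yes b<n = X (fromℕ< a<n) (fromℕ< b<n)
... | _       | _       = 0ℤ

entry-toℕ : ∀ {n} (X : Matrix n) x y → entry X (toℕ x) (toℕ y) ≡ X x y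
entry-toℕ {n} X x y with toℕ x ℕ.<? n | toℕ y ℕ.<? n
... | yes x<n | yes y<n = cong₂ X (FinP.fromℕ<-toℕ x x<n) (FinP.fromℕ<-toℕ y y<n)
... | no x≮n  | _       = ⊥-elim (x≮n (FinP.toℕ<n x))
... | yes _   | no y≮n  = ⊥-elim (y≮n (FinP.toℕ<n y))

entry-≡ : ∀ {n} (X : Matrix n) {x y a b} → toℕ x ≡ a → toℕ y ≡ b → X x y ≡ entry X a b
entry-≡ X refl refl = sym (entry-toℕ X _ _)

-- Off by one from rk: cornerSum X p q sums the first p rows and the first q columns.
cornerSum : ∀ {n} → Matrix n → ℕ → ℕ → ℤ
cornerSum X p q = ∑ p (λ a → ∑ q (entry X a))

rk≡cornerSum : ∀ {n} (X : Matrix n) x y → rk X x y ≡ cornerSum X (suc (toℕ x)) (suc (toℕ y))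
rk≡cornerSum {n} X x y = trans (rk-cong (λ a b → sym (entry-toℕ X a b)) x y) (rk-toℕ n (entry X) x y)

Bit : ℤ → Set
Bit z = z ≡ 0ℤ ⊎ z ≡ 1ℤ

Sign : ℤ → Set
Sign z = z ≡ -1ℤ ⊎ z ≡ 0ℤ ⊎ z ≡ 1ℤ

data BitWalk : ℤ → List ℤ → ℤ → Set where
  done : ∀ {s} → Bit s → BitWalk s [] s
  step : ∀ {s x xs t} → Bit s → BitWalk (s + x) xs t → BitWalk s (x ∷ xs) t

walk-head : ∀ {s xs t} → BitWalk s xs t → Bit s
walk-head (done b)   = b
walk-head (step b _) = b

walk-last : ∀ {s xs t} → BitWalk s xs t → Bit t
walk-last (done b)   = b
walk-last (step _ w) = walk-last w

walk-sum : ∀ {s xs t} → BitWalk s xs t → t ≡ s + sumℤ xs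
walk-sum {s} (done _)            = sym (ℤP.+-identityʳ s)
walk-sum {s} {x ∷ xs} (step _ w) = trans (walk-sum w) (ℤP.+-assoc s x (sumℤ xs))

walk-nonzeros : ∀ {s xs t} → BitWalk s xs t → BitWalk s (nonzeros xs) t
walk-nonzeros (done b) = done b
walk-nonzeros {s} {x ∷ xs} {t} (step b w) with x ℤP.≟ 0ℤ
... | yes refl = subst (λ u → BitWalk u (nonzeros xs) t) (ℤP.+-identityʳ s) (walk-nonzeros w)
... | no _     = step b (walk-nonzeros w)

walk-fromNonzeros : ∀ {s t} xs → BitWalk s (nonzeros xs) t → BitWalk s xs t
walk-fromNonzeros []       w = w
walk-fromNonzeros {s} {t} (x ∷ xs) w with x ℤP.≟ 0ℤ
walk-fromNonzeros {s} {t} (x ∷ xs) w          | yes refl =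
  let w′ = walk-fromNonzeros xs w in
  step (walk-head w′) (subst (λ u → BitWalk u xs t) (sym (ℤP.+-identityʳ s)) w′)
walk-fromNonzeros         (x ∷ xs) (step b w) | no _     = step b (walk-fromNonzeros xs w)

step-sign : ∀ {s x} → Bit s → Bit (s + x) → x ≢ 0ℤ → s ≡ 0ℤ × x ≡ 1ℤ ⊎ s ≡ 1ℤ × x ≡ -1ℤ
step-sign {x = x} (inj₁ refl) b x≢0 with subst Bit (ℤP.+-identityˡ x) b
... | inj₁ x≡0 = ⊥-elim (x≢0 x≡0)
... | inj₂ x≡1 = inj₁ (refl , x≡1)
step-sign {x = x} (inj₂ refl) b x≢0 with b
... | inj₁ 1+x≡0 = inj₂ (refl , trans (sym (ℤP.pred-suc x)) (cong (_+_ -1ℤ) 1+x≡0))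
... | inj₂ 1+x≡1 = ⊥-elim (x≢0 (trans (sym (ℤP.pred-suc x)) (cong (_+_ -1ℤ) 1+x≡1)))

steps-alternate : ∀ {s x y} → Bit s → Bit (s + x) → Bit (s + x + y) → x ≢ 0ℤ → y ≢ 0ℤ → y ≡ - x
steps-alternate bs bx bxy x≢0 y≢0 with step-sign bs bx x≢0 | step-sign bx bxy y≢0
... | inj₁ (refl , refl) | inj₁ (() , _)
... | inj₁ (refl , refl) | inj₂ (_ , refl) = refl
... | inj₂ (refl , refl) | inj₁ (_ , refl) = refl
... | inj₂ (refl , refl) | inj₂ (() , _)

walk-alternating : ∀ {s ys t} → BitWalk s ys t → All (_≢ 0ℤ) ys → Alternating ys
walk-alternating (done _)                  _                = alt-[]
walk-alternating (step _ (done _))         _                = alt-[ _ ]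
walk-alternating (step b w@(step b′ w′)) (x≢0 ∷ y≢0 ∷ nz) =
  alt-∷ (steps-alternate b b′ (walk-head w′) x≢0 y≢0) (walk-alternating w (y≢0 ∷ nz))

nonzeros-≢0 : ∀ xs → All (_≢ 0ℤ) (nonzeros xs)
nonzeros-≢0 = AllP.all-filter (λ x → ¬? (x ℤP.≟ 0ℤ))

walk₀₁-sum : ∀ {xs} → BitWalk 0ℤ xs 1ℤ → sumℤ xs ≡ 1ℤ
walk₀₁-sum w = sym (trans (walk-sum w) (ℤP.+-identityˡ _))

walk⇒altSum1 : ∀ {xs} → BitWalk 0ℤ xs 1ℤ → AltSum1 xs
walk⇒altSum1 {xs} w =
  walk-alternating (walk-nonzeros w) (nonzeros-≢0 xs) , walk₀₁-sum (walk-nonzeros w)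

alternating⇒walk : ∀ s {y ys} → Bit s → Bit (s + y) → Alternating (y ∷ ys) → ∃ λ t → BitWalk s (y ∷ ys) t
alternating⇒walk s {y} {[]}    b b′ _             = s + y , step b (done b′)
alternating⇒walk s {y} {_ ∷ _} b b′ (alt-∷ refl a) =
  let t , w = alternating⇒walk (s + y) b′ (subst Bit (sym (//-rightDividesʳ y s)) b) a in
  t , step b w

-- A leading -1 is impossible: the same entries walked from 1 would end at 1 + 1.
nonzero-altSum1⇒walk : ∀ ys → All Sign ys → All (_≢ 0ℤ) ys → Alternating ys → sumℤ ys ≡ 1ℤ →
  BitWalk 0ℤ ys 1ℤ
nonzero-altSum1⇒walk [] _ _ _ ()
nonzero-altSum1⇒walk (_ ∷ ys) (inj₁ refl ∷ _) _ alt sum≡1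
  with alternating⇒walk 1ℤ (inj₂ refl) (inj₁ refl) alt
... | t , w with trans (walk-sum w) (cong (_+_ 1ℤ) sum≡1) | walk-last w
...   | refl | inj₁ ()
...   | refl | inj₂ ()
nonzero-altSum1⇒walk (_ ∷ ys) (inj₂ (inj₁ refl) ∷ _) (0≢0 ∷ _) _ _ = ⊥-elim (0≢0 refl)
nonzero-altSum1⇒walk (_ ∷ ys) (inj₂ (inj₂ refl) ∷ _) _ alt sum≡1 =
  let t , w = alternating⇒walk 0ℤ (inj₁ refl) (inj₂ refl) alt in
  subst (BitWalk 0ℤ (1ℤ ∷ ys)) (trans (walk-sum w) (trans (ℤP.+-identityˡ _) sum≡1)) w

altSum1⇒walk : ∀ xs → All Sign xs → AltSum1 xs → BitWalk 0ℤ xs 1ℤ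
altSum1⇒walk xs signs (alt , sum≡1) = walk-fromNonzeros xs
  (nonzero-altSum1⇒walk (nonzeros xs) (AllP.filter⁺ (λ x → ¬? (x ℤP.≟ 0ℤ)) signs) (nonzeros-≢0 xs)
    alt sum≡1)

walk-prefix : ∀ m (g : ℕ → ℤ) {s t} → BitWalk s (applyUpTo g m) t → ∀ q → q ≤ m → Bit (s + ∑ q g)
walk-prefix m       g {s} w          zero    _         = subst Bit (sym (ℤP.+-identityʳ s)) (walk-head w)
walk-prefix (suc m) g {s} (step _ w) (suc q) (s≤s q≤m) =
  subst Bit (ℤP.+-assoc s (g 0) (∑ q (g ∘ suc))) (walk-prefix m (g ∘ suc) w q q≤m)

walk-differences : ∀ m (d : ℕ → ℤ) → (∀ q → q ≤ m → Bit (d q)) →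
  BitWalk (d 0) (applyUpTo (λ q → d (suc q) - d q) m) (d m)
walk-differences zero    d bits = done (bits 0 z≤n)
walk-differences (suc m) d bits = step (bits 0 z≤n)
  (subst (λ u → BitWalk u (applyUpTo (λ q → d (suc (suc q)) - d (suc q)) m) (d (suc m)))
    (sym (trans (ℤP.+-comm (d 0) _) (//-rightDividesˡ (d 0) (d 1))))
    (walk-differences m (d ∘ suc) (λ q q≤m → bits (suc q) (s≤s q≤m))))

line-walk : ∀ {n} (f : Fin n → ℤ) (g : ℕ → ℤ) → (∀ j → f j ≡ g (toℕ j)) → (∀ j → Sign (f j)) →
  AltSum1 (map f (allFin n)) → BitWalk 0ℤ (applyUpTo g n) 1ℤ
line-walk {n} f g f≗g signs alt = subst (λ l → BitWalk 0ℤ l 1ℤ)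
  (trans (ListP.map-cong f≗g (allFin n)) (map-allFin n g))
  (altSum1⇒walk _ (AllP.map⁺ (AllP.tabulate⁺ signs)) alt)

module _ {n} {X : Matrix n} (asm : IsASM X) where
  open IsASM asm

  row-walk : ∀ {p} → p < n → BitWalk 0ℤ (applyUpTo (entry X p) n) 1ℤ
  row-walk p<n = line-walk _ _ (λ _ → entry-≡ X (FinP.toℕ-fromℕ< p<n) refl) (entries _) (rows _)

  col-walk : ∀ {q} → q < n → BitWalk 0ℤ (applyUpTo (λ a → entry X a q) n) 1ℤ
  col-walk q<n = line-walk _ _ (λ _ → entry-≡ X refl (FinP.toℕ-fromℕ< q<n)) (λ i → entries i _) (cols _)

-- Robbins–Rumsey's characterisation of the corner sum matrices of n × n ASMs, indexed by [0,n]².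
record IsCornerSum (n : ℕ) (T : ℕ → ℕ → ℤ) : Set where
  field
    top    : ∀ q → T 0 q ≡ 0ℤ
    left   : ∀ p → T p 0 ≡ 0ℤ
    right  : ∀ p → p ≤ n → T p n ≡ + p
    bottom : ∀ q → q ≤ n → T n q ≡ + q
    down   : ∀ p q → p < n → q ≤ n → Bit (T (suc p) q - T p q)
    across : ∀ p q → p ≤ n → q < n → Bit (T p (suc q) - T p q)

cornerSum-down : ∀ {n} (X : Matrix n) p q → cornerSum X (suc p) q - cornerSum X p q ≡ ∑ q (entry X p)
cornerSum-down X p q = trans (cong (_- cornerSum X p q) (∑-suc p _)) (xyx⁻¹≈y (cornerSum X p q) _)

cornerSum-across : ∀ {n} (X : Matrix n) p q →
  cornerSum X p (suc q) - cornerSum X p q ≡ ∑ p (λ a → entry X a q)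
cornerSum-across X p q = trans (cong (_- cornerSum X p q) split) (xyx⁻¹≈y (cornerSum X p q) _)
  where
  split : cornerSum X p (suc q) ≡ cornerSum X p q + ∑ p (λ a → entry X a q)
  split = trans (∑-cong p (λ a _ → ∑-suc q (entry X a))) (∑-+ p _ _)

cornerSum-isCornerSum : ∀ {n} {X : Matrix n} → IsASM X → IsCornerSum n (cornerSum X)
cornerSum-isCornerSum {n} {X} asm = record
  { top    = λ _ → refl
  ; left   = ∑-zero
  ; right  = right
  ; bottom = bottom
  ; down   = λ p q p<n q≤n → subst Bit (sym (cornerSum-down X p q))
               (bit-0+ (walk-prefix n (entry X p) (row-walk asm p<n) q q≤n))
  ; across = λ p q p≤n q<n → subst Bit (sym (cornerSum-across X p q))
               (bit-0+ (walk-prefix n (λ a → entry X a q) (col-walk asm q<n) p p≤n))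
  }
  where
  bit-0+ : ∀ {z} → Bit (0ℤ + z) → Bit z
  bit-0+ = subst Bit (ℤP.+-identityˡ _)

  unit-step : ∀ {a b} p → a - b ≡ 1ℤ → b ≡ + p → a ≡ + suc p
  unit-step {a} {b} p a-b≡1 refl = trans (sym (//-rightDividesˡ b a)) (cong (_+ b) a-b≡1)

  right : ∀ p → p ≤ n → cornerSum X p n ≡ + p
  right zero    _   = refl
  right (suc p) p<n = unit-step p (trans (cornerSum-down X p n) (walk₀₁-sum (row-walk asm p<n)))
                        (right p (ℕP.<⇒≤ p<n))

  bottom : ∀ q → q ≤ n → cornerSum X n q ≡ + q
  bottom zero    _   = ∑-zero n
  bottom (suc q) q<n = unit-step q (trans (cornerSum-across X n q) (walk₀₁-sum (col-walk asm q<n)))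
                         (bottom q (ℕP.<⇒≤ q<n))

isCornerSum-transpose : ∀ {n T} → IsCornerSum n T → IsCornerSum n (λ p q → T q p)
isCornerSum-transpose T-cs = record
  { top    = left
  ; left   = top
  ; right  = bottom
  ; bottom = right
  ; down   = λ p q p<n q≤n → across q p q≤n p<n
  ; across = λ p q p≤n q<n → down q p q<n p≤n
  }
  where open IsCornerSum T-cs

cornerDifference : (ℕ → ℕ → ℤ) → ℕ → ℕ → ℤ
cornerDifference T p q = (T (suc p) (suc q) - T p (suc q)) - (T (suc p) q - T p q)

cornerDifference-transpose : ∀ T p q → cornerDifference T p q ≡ cornerDifference (λ a b → T b a) q p
cornerDifference-transpose T p q = swap-middle (T (suc p) (suc q)) (T p (suc q)) (T (suc p) q) (T p q)
  where
  swap-middle : ∀ a b c d → (a - b) - (c - d) ≡ (a - c) - (b - d)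
  swap-middle = solve-∀

fromCornerSum : ∀ n → (ℕ → ℕ → ℤ) → Matrix n
fromCornerSum n T x y = cornerDifference T (toℕ x) (toℕ y)

bit-difference-sign : ∀ {a b} → Bit a → Bit b → Sign (a - b)
bit-difference-sign (inj₁ refl) (inj₁ refl) = inj₂ (inj₁ refl)
bit-difference-sign (inj₁ refl) (inj₂ refl) = inj₁ refl
bit-difference-sign (inj₂ refl) (inj₁ refl) = inj₂ (inj₂ refl)
bit-difference-sign (inj₂ refl) (inj₂ refl) = inj₂ (inj₁ refl)

differences-altSum1 : ∀ m (d : ℕ → ℤ) → (∀ q → q ≤ m → Bit (d q)) → d 0 ≡ 0ℤ → d m ≡ 1ℤ →
  AltSum1 (applyUpTo (λ q → d (suc q) - d q) m)
differences-altSum1 m d bits d0≡0 dm≡1 =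
  walk⇒altSum1 (subst₂ (λ s t → BitWalk s (applyUpTo (λ q → d (suc q) - d q) m) t) d0≡0 dm≡1
    (walk-differences m d bits))

module _ {n T} (T-cs : IsCornerSum n T) where
  open IsCornerSum T-cs

  rk-fromCornerSum : ∀ x y → rk (fromCornerSum n T) x y ≡ T (suc (toℕ x)) (suc (toℕ y))
  rk-fromCornerSum x y = begin
    rk (fromCornerSum n T) x y                               ≡⟨ rk-toℕ n (cornerDifference T) x y ⟩
    ∑ (suc p) (λ a → ∑ (suc q) (cornerDifference T a))        ≡⟨ ∑-cong (suc p) (λ a _ → row-telescope a) ⟩
    ∑ (suc p) (λ a → T (suc a) (suc q) - T a (suc q))         ≡⟨ ∑-telescope (suc p) (λ a → T a (suc q)) ⟩
    T (suc p) (suc q) - T 0 (suc q)                           ≡⟨ cong (_-_ (T (suc p) (suc q))) (top (suc q)) ⟩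
    T (suc p) (suc q) - 0ℤ                                    ≡⟨ ℤP.+-identityʳ _ ⟩
    T (suc p) (suc q)                                         ∎
    where
    open ≡-Reasoning
    p = toℕ x
    q = toℕ y
    row-telescope : ∀ a → ∑ (suc q) (cornerDifference T a) ≡ T (suc a) (suc q) - T a (suc q)
    row-telescope a = begin
      ∑ (suc q) (cornerDifference T a)  ≡⟨ ∑-telescope (suc q) D ⟩
      D (suc q) - D 0                   ≡⟨ cong (_-_ (D (suc q))) (cong₂ _-_ (left (suc a)) (left a)) ⟩
      D (suc q) - 0ℤ                    ≡⟨ ℤP.+-identityʳ _ ⟩
      D (suc q)                         ∎
      where
      D : ℕ → ℤ
      D b = T (suc a) b - T a b

  fromCornerSum-rows : ∀ i → AltSum1 (row (fromCornerSum n T) i)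
  fromCornerSum-rows i = subst AltSum1 (sym (map-allFin n (cornerDifference T p)))
    (differences-altSum1 n (λ q → T (suc p) q - T p q) (λ q → down p q p<n)
      (cong₂ _-_ (left (suc p)) (left p))
      (trans (cong₂ _-_ (right (suc p) p<n) (right p (ℕP.<⇒≤ p<n))) (//-rightDividesʳ (+ p) 1ℤ)))
    where
    p = toℕ i
    p<n = FinP.toℕ<n i

fromCornerSum-isASM : ∀ {n T} → IsCornerSum n T → IsASM (fromCornerSum n T)
fromCornerSum-isASM {n} {T} T-cs = record
  { entries = λ i j → bit-difference-sign (down (toℕ i) (suc (toℕ j)) (FinP.toℕ<n i) (FinP.toℕ<n j))
                                          (down (toℕ i) (toℕ j) (FinP.toℕ<n i) (ℕP.<⇒≤ (FinP.toℕ<n j)))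
  ; rows    = fromCornerSum-rows T-cs
  ; cols    = λ j → subst AltSum1 (ListP.map-cong (transposed j) (allFin n))
                (fromCornerSum-rows (isCornerSum-transpose T-cs) j)
  }
  where
  open IsCornerSum T-cs
  transposed : ∀ j i → fromCornerSum n (λ p q → T q p) j i ≡ fromCornerSum n T i j
  transposed j i = sym (cornerDifference-transpose T (toℕ i) (toℕ j))

bit-difference⇒bounds : ∀ {a b} → Bit (b - a) → a ≤ᶻ b × b ≤ᶻ 1ℤ + a
bit-difference⇒bounds {a} {b} (inj₁ b-a≡0) =
  ℤP.≤-reflexive (sym b≡a) , ℤP.≤-trans (ℤP.≤-reflexive b≡a) (ℤP.i≤suc[i] a)
  where b≡a = ℤP.i-j≡0⇒i≡j b a b-a≡0
bit-difference⇒bounds {a} {b} (inj₂ b-a≡1) =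
  ℤP.≤-trans (ℤP.i≤suc[i] a) (ℤP.≤-reflexive (sym b≡1+a)) , ℤP.≤-reflexive b≡1+a
  where b≡1+a = trans (sym (//-rightDividesˡ a b)) (cong (_+ a) b-a≡1)

bounds⇒bit-difference : ∀ {a b} → a ≤ᶻ b → b ≤ᶻ 1ℤ + a → Bit (b - a)
bounds⇒bit-difference {a} {b} a≤b b≤1+a = bit (ℤP.i≤j⇒0≤j-i a≤b)
  (ℤP.≤-trans (ℤP.+-monoˡ-≤ (- a) b≤1+a) (ℤP.≤-reflexive (//-rightDividesʳ a 1ℤ)))
  where
  bit : ∀ {z} → 0ℤ ≤ᶻ z → z ≤ᶻ 1ℤ → Bit z
  bit {+ 0}     _ _ = inj₁ refl
  bit {+ 1}     _ _ = inj₂ refl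
  bit {+ suc (suc _)} _ (+≤+ (s≤s ()))

bit-difference-⊔ : ∀ a b c d → Bit (b - a) → Bit (d - c) → Bit ((b ⊔ d) - (a ⊔ c))
bit-difference-⊔ a b c d ab cd =
  let a≤b , b≤1+a = bit-difference⇒bounds {a} {b} ab
      c≤d , d≤1+c = bit-difference⇒bounds {c} {d} cd
  in bounds⇒bit-difference (ℤP.⊔-mono-≤ a≤b c≤d)
       (ℤP.⊔-lub (ℤP.≤-trans b≤1+a (ℤP.suc-mono (ℤP.i≤i⊔j a c)))
                 (ℤP.≤-trans d≤1+c (ℤP.suc-mono (ℤP.i≤j⊔i a c))))

⊔-isCornerSum : ∀ {n P Q} → IsCornerSum n P → IsCornerSum n Q → IsCornerSum n (λ p q → P p q ⊔ Q p q)
⊔-isCornerSum {P = P} {Q} P-cs Q-cs = record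
  { top    = λ q → cong₂ _⊔_ (P.top q) (Q.top q)
  ; left   = λ p → cong₂ _⊔_ (P.left p) (Q.left p)
  ; right  = λ p p≤n → trans (cong₂ _⊔_ (P.right p p≤n) (Q.right p p≤n)) (ℤP.⊔-idem (+ p))
  ; bottom = λ q q≤n → trans (cong₂ _⊔_ (P.bottom q q≤n) (Q.bottom q q≤n)) (ℤP.⊔-idem (+ q))
  ; down   = λ p q p<n q≤n → bit-difference-⊔ (P p q) (P (suc p) q) (Q p q) (Q (suc p) q)
                               (P.down p q p<n q≤n) (Q.down p q p<n q≤n)
  ; across = λ p q p≤n q<n → bit-difference-⊔ (P p q) (P p (suc q)) (Q p q) (Q p (suc q))
                               (P.across p q p≤n q<n) (Q.across p q p≤n q<n)
  }
  where
  module P = IsCornerSum P-cs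
  module Q = IsCornerSum Q-cs

_∨_ : ∀ {n} → Matrix n → Matrix n → Matrix n
_∨_ {n} X Y = fromCornerSum n (λ p q → cornerSum X p q ⊔ cornerSum Y p q)

∨-isASM : ∀ {n} {X Y : Matrix n} → IsASM X → IsASM Y → IsASM (X ∨ Y)
∨-isASM X-asm Y-asm =
  fromCornerSum-isASM (⊔-isCornerSum (cornerSum-isCornerSum X-asm) (cornerSum-isCornerSum Y-asm))

rk-∨ : ∀ {n} {X Y : Matrix n} → IsASM X → IsASM Y → ∀ x y → rk (X ∨ Y) x y ≡ rk X x y ⊔ rk Y x y
rk-∨ {X = X} {Y} X-asm Y-asm x y = trans
  (rk-fromCornerSum (⊔-isCornerSum (cornerSum-isCornerSum X-asm) (cornerSum-isCornerSum Y-asm)) x y)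
  (sym (cong₂ _⊔_ (rk≡cornerSum X x y) (rk≡cornerSum Y x y)))

theorem3p6 : (n : ℕ) (A B : Matrix n) → IsASM A → IsASM B → A ≤ₛ B →
    (i : Fin n) → suc (toℕ i) < n →
    (PA PB : Matrix n) → IsPi i A PA → IsPi i B PB → PA ≤ₛ PB
theorem3p6 n A B _ _ A≤B i _ PA PB πA πB x y = begin
  rk PB x y              ≤⟨ ℤP.i≤j⊔i (rk PA x y) (rk PB x y) ⟩
  rk PA x y ⊔ rk PB x y  ≡⟨ rk-∨ PA-asm PB-asm x y ⟨
  rk (PA ∨ PB) x y       ≤⟨ IsPi.minimal πA (PA ∨ PB) (∨-isASM PA-asm PB-asm) ∨-agrees x y ⟩
  rk PA x y              ∎
  where
  open ℤP.≤-Reasoning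
  PA-asm = IsPi.isASM πA
  PB-asm = IsPi.isASM πB
  ∨-agrees : ∀ a b → a ≢ i → rk (PA ∨ PB) a b ≡ rk A a b
  ∨-agrees a b a≢i = begin-equality
    rk (PA ∨ PB) a b     ≡⟨ rk-∨ PA-asm PB-asm a b ⟩
    rk PA a b ⊔ rk PB a b ≡⟨ cong₂ _⊔_ (IsPi.agrees πA a b a≢i) (IsPi.agrees πB a b a≢i) ⟩
    rk A a b ⊔ rk B a b  ≡⟨ ℤP.i≥j⇒i⊔j≡i (A≤B a b) ⟩
    rk A a b             ∎
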